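{- Let $r\ge 3$ be an integer and let $D$ be a finite digraph without $(r-1)$-source sets. Let $D'$ be the digraph on $V(D)$ obtained from $D$ by taking each proper $(r-2)$-pseudo-source set $S$ of $D$ and adding all possible arcs (in both directions) between distinct vertices of $N^-_D(S)$. Then $D'$ contains no $(r-2)$-pseudo-source sets.
   Context: For $S\subseteq V(D)$, $N^-_D(S)=\{u\in V(D)\setminus S:\exists v\in S,\ uv\in E(D)\}$. $S$ is a source set if $N^-_D(S)=\emptyset$; it is an $s$-source set if additionally $S\ne\emptyset$ and $|S|\le s$. A non-empty set $S$ is a pseudo-source set if every $v\in N^-_D(S)$ satisfies $N^-_D(\{v\})\subseteq S$; it is an $s$-pseudo-source set if also $|S|\le s$. A pseudo-source set $S$ is proper if no non-empty proper subset $T\subsetneq S$ is a pseudo-source set. -}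

module Defs where

open import Data.Nat using (ℕ; _≤_)
open import Data.Fin using (Fin)
open import Data.Fin.Subset using (Subset; _∈_; _∉_; _⊂_; ∣_∣; Nonempty; ⁅_⁆)
open import Data.Bool using (Bool; T)
open import Data.Product using (Σ; ∃; _×_)
open import Data.Sum using (_⊎_)
open import Relation.Binary.PropositionalEquality using (_≢_)
open import Relation.Nullary using (¬_)

-- A finite digraph on vertex set Fin n, given by a (decidable) adjacency
-- function: D u v = true  iff  uv ∈ E(D) (arc from u to v).
Digraph : ℕ → Set
Digraph n = Fin n → Fin n → Bool

Rel : ℕ → Set₁
Rel n = Fin n → Fin n → Set

Arc : ∀ {n} → Digraph n → Rel n
Arc D u v = T (D u v)

InNbr : ∀ {n} → Rel n → Subset n → Fin n → Set
InNbr E S u = u ∉ S × ∃ λ v → v ∈ S × E u v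

SourceSet : ∀ {n} → Rel n → Subset n → Set
SourceSet E S = ∀ u → ¬ InNbr E S u

sSourceSet : ∀ {n} → ℕ → Rel n → Subset n → Set
sSourceSet s E S = SourceSet E S × Nonempty S × ∣ S ∣ ≤ s

PseudoSource : ∀ {n} → Rel n → Subset n → Set
PseudoSource E S = Nonempty S × (∀ v → InNbr E S v → ∀ w → InNbr E ⁅ v ⁆ w → w ∈ S)

sPseudoSource : ∀ {n} → ℕ → Rel n → Subset n → Set
sPseudoSource s E S = PseudoSource E S × ∣ S ∣ ≤ s

ProperPseudoSource : ∀ {n} → Rel n → Subset n → Set
ProperPseudoSource E S =
  PseudoSource E S × (∀ T → Nonempty T → T ⊂ S → ¬ PseudoSource E T)

Augment : ∀ {n} → ℕ → Digraph n → Rel n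
Augment s D u v =
  Arc D u v ⊎
  (u ≢ v × Σ (Subset _) λ S →
     ProperPseudoSource (Arc D) S × ∣ S ∣ ≤ s × InNbr (Arc D) S u × InNbr (Arc D) S v)

-- A pseudo-source set S of D' is one of D, so it contains a proper pseudo-source set T of D.
-- The closed in-neighbourhood T ∪ N⁻_D(T) is then a non-empty source set of D, hence has more
-- than r - 1 vertices. But two distinct in-neighbours u, v of T outside S are impossible: u lies
-- in N⁻_D'(S) and D' has the arc vu, which forces v ∈ S. So T ∪ N⁻_D(T) ⊆ S ∪ {u}, which has at
-- most r - 1 vertices.
-- The conclusion is a negation, so the classical steps (choosing a minimal T, forming
-- T ∪ N⁻_D(T) as a subset) are carried out under double negation.
module Submission where

open import Defs
open import Data.Nat using (ℕ; _≤_; _∸_; _+_; zero; suc; z≤n; s≤s)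
open import Data.Nat.Properties using (≤-trans; ≤-reflexive; n≤1+n; +-suc; +-comm; +-monoʳ-≤; module ≤-Reasoning)
open import Data.Fin using (Fin; zero; suc; _≟_)
open import Data.Fin.Subset using (Subset; inside; outside; _∈_; _∉_; _⊆_; _⊂_; _∪_; ∣_∣; Nonempty; ⁅_⁆)
open import Data.Fin.Subset.Properties
  using (_∈?_; ⊆-refl; ⊆-trans; p⊂q⇒p⊆q; p⊆q⇒∣p∣≤∣q∣; x∈p∪q⁺; x∈⁅x⁆; x∈⁅y⁆⇒x≡y; ∣⁅x⁆∣≡1; drop-there)
open import Data.Fin.Subset.Induction using (⊂-wellFounded)
open import Data.Fin.Properties using (any?)
open import Data.Vec using ([]; _∷_; here; there)
open import Data.Product using (∃; _×_; _,_; proj₂)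
open import Data.Sum using (_⊎_; inj₁; inj₂; [_,_])
open import Function using (_∘_; id; _⇔_; mk⇔; Equivalence)
open import Induction.WellFounded using (Acc; acc)
open import Level using (Level)
open import Relation.Binary.Core using (_⇒_)
open import Relation.Binary.PropositionalEquality using (_≡_; sym; cong; subst)
open import Relation.Nullary using (¬_; yes; no; ¬?; contradiction)
open import Relation.Nullary.Decidable using (_×-dec_; decidable-stable; ¬¬-excluded-middle)

open Equivalence using (to; from)

private
  variable
    ℓ : Level
    n : ℕ

∣p∪q∣≤∣p∣+∣q∣ : (p q : Subset n) → ∣ p ∪ q ∣ ≤ ∣ p ∣ + ∣ q ∣
∣p∪q∣≤∣p∣+∣q∣ []          []          = z≤n
∣p∪q∣≤∣p∣+∣q∣ (inside ∷ p)  (inside ∷ q)  =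
  s≤s (≤-trans (∣p∪q∣≤∣p∣+∣q∣ p q) (+-monoʳ-≤ ∣ p ∣ (n≤1+n ∣ q ∣)))
∣p∪q∣≤∣p∣+∣q∣ (inside ∷ p)  (outside ∷ q) = s≤s (∣p∪q∣≤∣p∣+∣q∣ p q)
∣p∪q∣≤∣p∣+∣q∣ (outside ∷ p) (inside ∷ q)  =
  ≤-trans (s≤s (∣p∪q∣≤∣p∣+∣q∣ p q)) (≤-reflexive (sym (+-suc ∣ p ∣ ∣ q ∣)))
∣p∪q∣≤∣p∣+∣q∣ (outside ∷ p) (outside ∷ q) = ∣p∪q∣≤∣p∣+∣q∣ p q

∣p∪⁅x⁆∣≤1+∣p∣ : (p : Subset n) (x : Fin n) → ∣ p ∪ ⁅ x ⁆ ∣ ≤ suc ∣ p ∣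
∣p∪⁅x⁆∣≤1+∣p∣ p x = begin
  ∣ p ∪ ⁅ x ⁆ ∣     ≤⟨ ∣p∪q∣≤∣p∣+∣q∣ p ⁅ x ⁆ ⟩
  ∣ p ∣ + ∣ ⁅ x ⁆ ∣ ≡⟨ cong (∣ p ∣ +_) (∣⁅x⁆∣≡1 x) ⟩
  ∣ p ∣ + 1         ≡⟨ +-comm ∣ p ∣ 1 ⟩
  suc ∣ p ∣         ∎
  where open ≤-Reasoning

∣p∣≤1+∣q∣ : {p q : Subset n} →
  (∀ {x y} → x ∈ p → x ∉ q → y ∈ p → y ∉ q → x ≡ y) → ∣ p ∣ ≤ suc ∣ q ∣
∣p∣≤1+∣q∣ {p = p} {q} atMostOneOutside with any? (λ x → x ∈? p ×-dec ¬? (x ∈? q))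
... | yes (u , u∈p , u∉q) = ≤-trans (p⊆q⇒∣p∣≤∣q∣ p⊆q∪⁅u⁆) (∣p∪⁅x⁆∣≤1+∣p∣ q u)
  where
  p⊆q∪⁅u⁆ : p ⊆ q ∪ ⁅ u ⁆
  p⊆q∪⁅u⁆ {x} x∈p with x ∈? q
  ... | yes x∈q = x∈p∪q⁺ (inj₁ x∈q)
  ... | no  x∉q = x∈p∪q⁺ (inj₂ (subst (_∈ ⁅ u ⁆) (atMostOneOutside u∈p u∉q x∈p x∉q) (x∈⁅x⁆ u)))
... | no noneOutside = ≤-trans (p⊆q⇒∣p∣≤∣q∣ p⊆q) (n≤1+n ∣ q ∣)
  where
  p⊆q : p ⊆ q
  p⊆q {x} x∈p = decidable-stable (x ∈? q) (λ x∉q → noneOutside (x , x∈p , x∉q))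

¬¬-subset : (P : Fin n → Set ℓ) → ¬ ¬ (∃ λ X → ∀ i → i ∈ X ⇔ P i)
¬¬-subset {zero}  P k = k ([] , λ ())
¬¬-subset {suc n} P k =
  ¬¬-subset (P ∘ suc) λ (X , X⇔) → ¬¬-excluded-middle λ
    { (yes P0) → k (inside ∷ X , λ
        { zero    → mk⇔ (λ _ → P0) (λ _ → here)
        ; (suc i) → mk⇔ (to (X⇔ i) ∘ drop-there) (there ∘ from (X⇔ i)) })
    ; (no ¬P0) → k (outside ∷ X , λ
        { zero    → mk⇔ (λ ()) (λ P0 → contradiction P0 ¬P0)
        ; (suc i) → mk⇔ (to (X⇔ i) ∘ drop-there) (there ∘ from (X⇔ i)) }) }

¬¬-minimal-⊆ : {P : Subset n → Set ℓ} {S : Subset n} → Acc _⊂_ S → P S →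
  ¬ ¬ (∃ λ T → T ⊆ S × P T × ∀ T′ → T′ ⊂ T → ¬ P T′)
¬¬-minimal-⊆ {P = P} {S} (acc rs) PS k = ¬¬-excluded-middle {A = ∃ λ T′ → T′ ⊂ S × P T′} λ
  { (yes (T′ , T′⊂S , PT′)) → ¬¬-minimal-⊆ (rs T′⊂S) PT′ λ (T , T⊆T′ , PT , minT) →
      k (T , ⊆-trans T⊆T′ (p⊂q⇒p⊆q T′⊂S) , PT , minT)
  ; (no noSmaller) → k (S , ⊆-refl , PS , λ T′ T′⊂S PT′ → noSmaller (T′ , T′⊂S , PT′)) }

InNbr-mono : {E E′ : Rel n} {S : Subset n} {u : Fin n} → E ⇒ E′ → InNbr E S u → InNbr E′ S u
InNbr-mono E⇒E′ (u∉S , v , v∈S , uv) = u∉S , v , v∈S , E⇒E′ uv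

InNbr-⊆ : {E : Rel n} {S T : Subset n} {u : Fin n} → T ⊆ S → u ∉ S → InNbr E T u → InNbr E S u
InNbr-⊆ T⊆S u∉S (_ , v , v∈T , uv) = u∉S , v , T⊆S v∈T , uv

PseudoSource-antimono : {E E′ : Rel n} {S : Subset n} → E ⇒ E′ → PseudoSource E′ S → PseudoSource E S
PseudoSource-antimono {E = E} E⇒E′ (S≠∅ , closed) =
  S≠∅ , λ v v∈N⁻S w w∈N⁻v → closed v (InNbr-mono {E = E} E⇒E′ v∈N⁻S) w (InNbr-mono {E = E} E⇒E′ w∈N⁻v)

Arc⇒Augment : (s : ℕ) (D : Digraph n) → Arc D ⇒ Augment s D
Arc⇒Augment s D = inj₁

InClosedNbhd : Rel n → Subset n → Fin n → Set
InClosedNbhd E T i = i ∈ T ⊎ InNbr E T i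

closedNbhd-sourceSet : {E : Rel n} {T X : Subset n} → PseudoSource E T →
  (∀ i → i ∈ X ⇔ InClosedNbhd E T i) → SourceSet E X
closedNbhd-sourceSet {T = T} (_ , closed) X⇔ u (u∉X , v , v∈X , uv) with to (X⇔ v) v∈X
... | inj₁ v∈T   = u∉X (from (X⇔ u) (inj₂ (u∉T , v , v∈T , uv)))
  where
  u∉T : u ∉ T
  u∉T = u∉X ∘ from (X⇔ u) ∘ inj₁
... | inj₂ v∈N⁻T = u∉X (from (X⇔ u) (inj₁ (closed v v∈N⁻T u (u∉⁅v⁆ , v , x∈⁅x⁆ v , uv))))
  where
  u∉⁅v⁆ : u ∉ ⁅ v ⁆
  u∉⁅v⁆ u∈⁅v⁆ = u∉X (subst (_∈ _) (sym (x∈⁅y⁆⇒x≡y v u∈⁅v⁆)) v∈X)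

module _ {s : ℕ} {D : Digraph n} {S T : Subset n}
  (psS : PseudoSource (Augment s D) S) (properT : ProperPseudoSource (Arc D) T)
  (∣T∣≤s : ∣ T ∣ ≤ s) (T⊆S : T ⊆ S) where

  inNbr-outside-unique : {u v : Fin n} → u ∉ S → v ∉ S →
    InNbr (Arc D) T u → InNbr (Arc D) T v → u ≡ v
  inNbr-outside-unique {u} {v} u∉S v∉S u∈N⁻T v∈N⁻T = decidable-stable (u ≟ v) λ u≢v →
    v∉S (proj₂ psS u u∈N⁻S v (v∉⁅u⁆ u≢v , u , x∈⁅x⁆ u , inj₂ (u≢v ∘ sym , T , properT , ∣T∣≤s , v∈N⁻T , u∈N⁻T)))
    where
    u∈N⁻S : InNbr (Augment s D) S u
    u∈N⁻S = InNbr-mono {E = Arc D} (Arc⇒Augment s D) (InNbr-⊆ {E = Arc D} T⊆S u∉S u∈N⁻T)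
    v∉⁅u⁆ : ¬ u ≡ v → v ∉ ⁅ u ⁆
    v∉⁅u⁆ u≢v v∈⁅u⁆ = u≢v (sym (x∈⁅y⁆⇒x≡y u v∈⁅u⁆))

  ∣closedNbhd∣≤1+∣S∣ : {X : Subset n} → (∀ i → i ∈ X ⇔ InClosedNbhd (Arc D) T i) → ∣ X ∣ ≤ suc ∣ S ∣
  ∣closedNbhd∣≤1+∣S∣ {X} X⇔ = ∣p∣≤1+∣q∣ λ x∈X x∉S y∈X y∉S →
    inNbr-outside-unique x∉S y∉S (outside⇒inNbr x∈X x∉S) (outside⇒inNbr y∈X y∉S)
    where
    outside⇒inNbr : ∀ {x} → x ∈ X → x ∉ S → InNbr (Arc D) T x
    outside⇒inNbr {x} x∈X x∉S = [ (λ x∈T → contradiction (T⊆S x∈T) x∉S) , id ] (to (X⇔ x) x∈X)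

noPseudoSource-Augment : (s : ℕ) (D : Digraph n) →
  (∀ S → ¬ sSourceSet (suc s) (Arc D) S) → ∀ S → ¬ sPseudoSource s (Augment s D) S
noPseudoSource-Augment s D noSourceSet S (psS , ∣S∣≤s) =
  ¬¬-minimal-⊆ {P = PseudoSource (Arc D)} (⊂-wellFounded S) psS-in-D
    λ (T , T⊆S , psT@((t , t∈T) , _) , minT) →
  ¬¬-subset (InClosedNbhd (Arc D) T) λ (X , X⇔) →
  let properT : ProperPseudoSource (Arc D) T
      properT = psT , λ T′ _ → minT T′
      ∣T∣≤s : ∣ T ∣ ≤ s
      ∣T∣≤s = ≤-trans (p⊆q⇒∣p∣≤∣q∣ T⊆S) ∣S∣≤s
  in noSourceSet X
       ( closedNbhd-sourceSet psT X⇔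
       , (t , from (X⇔ t) (inj₁ t∈T))
       , ≤-trans (∣closedNbhd∣≤1+∣S∣ psS properT ∣T∣≤s T⊆S X⇔) (s≤s ∣S∣≤s) )
  where
  psS-in-D : PseudoSource (Arc D) S
  psS-in-D = PseudoSource-antimono (Arc⇒Augment s D) psS

lemma5p7 : (r : ℕ) → 3 ≤ r → (n : ℕ) → (D : Digraph n) →
    (∀ (S : Subset n) → ¬ sSourceSet (r ∸ 1) (Arc D) S) →
    ∀ (S : Subset n) → ¬ sPseudoSource (r ∸ 2) (Augment (r ∸ 2) D) S
lemma5p7 (suc (suc (suc k))) (s≤s (s≤s (s≤s _))) n D = noPseudoSource-Augment (suc k) D
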